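{- For all integers $m,n\geq 2$, $W(T(2m,2n))\geq \max\{3m+n+2,\,3n+m+2\}$. For every integer $m\geq 2$ and every positive integer $n$, the torus $T(2m,2n+1)$ satisfies $$W(T(2m,2n+1))\geq\begin{cases}2m+2n+2,& \text{if } m \text{ is odd},\\ 2m+2n+3,& \text{if } m \text{ is even}.\end{cases}$$
   Context: All graphs are finite, undirected, without loops or multiple edges. An edge-coloring of a graph $G$ with colors $1,\ldots,t$ is an interval $t$-coloring if all $t$ colors are used, and the colors of the edges incident to each vertex are distinct and form an interval of consecutive integers. A graph is interval colorable if it has an interval $t$-coloring for some positive integer $t$; for such a graph, $W(G)$ is the greatest such $t$. The torus $T(a,b)$ is the Cartesian product $C_a\square C_b$ of the cycles on $a$ and $b$ vertices; it is interval colorable whenever $ab$ is even. The Cartesian product $G\square H$ has vertex set $V(G)\times V(H)$, with $(u_1,v_1)(u_2,v_2)$ an edge iff either $u_1=u_2$ and $v_1v_2\in E(H)$, or $v_1=v_2$ and $u_1u_2\in E(G)$. -}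

module Defs where

open import Data.Nat using (ℕ; zero; suc; _≤_; _+_; _*_)
open import Data.Fin using (Fin; toℕ)
open import Data.Product using (_×_; Σ; ∃; ∃-syntax; _,_)
open import Data.Sum using (_⊎_)
open import Relation.Binary.PropositionalEquality using (_≡_)

record Graph : Set₁ where
  field
    V   : Set
    Adj : V → V → Set

CycSucc : (k : ℕ) → Fin k → Fin k → Set
CycSucc k i j = (toℕ j ≡ suc (toℕ i)) ⊎ ((suc (toℕ i) ≡ k) × (toℕ j ≡ 0))

CycAdj : (k : ℕ) → Fin k → Fin k → Set
CycAdj k i j = CycSucc k i j ⊎ CycSucc k j i

_□_ : Graph → Graph → Graph
G □ H = record
  { V   = Graph.V G × Graph.V H
  ; Adj = λ { (u₁ , v₁) (u₂ , v₂) →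
             ((u₁ ≡ u₂) × Graph.Adj H v₁ v₂) ⊎ ((v₁ ≡ v₂) × Graph.Adj G u₁ u₂) } }

Cycle : ℕ → Graph
Cycle k = record { V = Fin k ; Adj = CycAdj k }

Torus : ℕ → ℕ → Graph
Torus a b = Cycle a □ Cycle b

-- An edge-colouring is a function c on ordered pairs, required to be symmetric on edges
-- (so it is a function of the unordered edge); values on non-edges are irrelevant.
record IsIntervalColoring (G : Graph) (t : ℕ) (c : Graph.V G → Graph.V G → ℕ) : Set where
  open Graph G
  field
    symm     : ∀ u v → Adj u v → c u v ≡ c v u
    range    : ∀ u v → Adj u v → (1 ≤ c u v) × (c u v ≤ t)
    allUsed  : ∀ k → 1 ≤ k → k ≤ t → ∃[ u ] ∃[ v ] (Adj u v × c u v ≡ k)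
    proper   : ∀ u v w → Adj u v → Adj u w → c u v ≡ c u w → v ≡ w
    interval : ∀ u v w k → Adj u v → Adj u w → c u v ≤ k → k ≤ c u w →
               ∃[ x ] (Adj u x × c u x ≡ k)

HasIntervalColoring : Graph → ℕ → Set
HasIntervalColoring G t = Σ (Graph.V G → Graph.V G → ℕ) (IsIntervalColoring G t)

-- "W(G) ≥ N": since W(G) is the greatest t admitting an interval t-colouring,
-- W(G) ≥ N holds iff some interval t-colouring with t ≥ N exists.
W≥ : Graph → ℕ → Set
W≥ G N = ∃[ t ] ((N ≤ t) × HasIntervalColoring G t)

module Submission where

-- All colourings are built from "windows".  Every vertex (x,y) of C_a □ C_b gets a
-- base colour S(x,y); its four incident edges (towards x+1, x-1, y+1, y-1) receive
-- S(x,y) plus four offsets that form a permutation of {0,1,2,3}.  If the two ends of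
-- every edge agree on its colour, the colouring is proper and every vertex sees the
-- interval [S, S+3]; if in addition the windows cover [1,t], it is an interval
-- t-colouring (windowColouring).
--
-- In both constructions the base colour is a sum 1 + A(x) + B(y) of a row profile and
-- a column profile, and agreement on edges reduces to one-dimensional "step equations"
-- around each cycle (productColouring).  Covering [1,t] follows by walking from (0,0)
-- to a peak vertex along which S grows by at most 3 per step (windowChain).
--
-- The colourings of T(2m,2n) with 3m+n+2 colours and of T(2m,2n+1) with
-- ascent(m-1)+2n+4 colours are then given by explicit profiles (EvenTorus, OddTorus).
-- The bound 3n+m+2 for T(2m,2n) follows from the symmetry T(a,b) ≅ T(b,a) (W≥-swap),
-- and ascent(m-1) = 2(m-1) + [m even] yields the two bounds for T(2m,2n+1).

open import Defs
open import Data.Nat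
open import Data.Nat.Properties
open import Data.Nat.Tactic.RingSolver using (solve-∀)
open import Data.Bool using (Bool; true; false; if_then_else_; not)
open import Data.Fin using (Fin; toℕ; fromℕ<)
open import Data.Fin.Properties using (toℕ<n; toℕ-injective; toℕ-fromℕ<)
open import Data.Empty using (⊥; ⊥-elim)
open import Data.Product using (Σ; _×_; ∃-syntax; _,_; proj₁; proj₂; swap)
open import Data.Sum using (_⊎_; inj₁; inj₂)
open import Relation.Binary using (tri<; tri≈; tri>)
open import Relation.Binary.PropositionalEquality
  using (_≡_; _≢_; refl; sym; trans; cong; cong₂; subst; subst₂; module ≡-Reasoning)
open import Relation.Nullary using (Dec; yes; no; does)
open import Relation.Nullary.Decidable
  using (True; toWitness; map′; dec-true; dec-false; ¬?; _×-dec_; _⊎-dec_)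

next : ℕ → ℕ → ℕ
next k x = if does (suc x ≟ k) then 0 else suc x

prev : ℕ → ℕ → ℕ
prev k zero    = k ∸ 1
prev k (suc x) = x

data NextView (k x : ℕ) : Set where
  wraps : suc x ≡ k → next k x ≡ 0 → NextView k x
  steps : suc x < k → next k x ≡ suc x → NextView k x

next-wrap : ∀ {k x} → suc x ≡ k → next k x ≡ 0
next-wrap {k} {x} e rewrite dec-true (suc x ≟ k) e = refl

next-step : ∀ {k x} → suc x < k → next k x ≡ suc x
next-step {k} {x} lt rewrite dec-false (suc x ≟ k) (<⇒≢ lt) = refl

nextView : ∀ {k x} → x < k → NextView k x
nextView {k} {x} x<k with suc x ≟ k
... | yes e  = wraps e (next-wrap e)
... | no  ne = steps (≤∧≢⇒< x<k ne) (next-step (≤∧≢⇒< x<k ne))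

aroundCycle : ∀ {k} (R : ℕ → ℕ → Set) →
  (∀ {x} → suc x < k → R x (suc x)) → (∀ {x} → suc x ≡ k → R x 0) →
  ∀ {x} → x < k → R x (next k x)
aroundCycle R step wrap x<k with nextView x<k
... | wraps e eq = subst (R _) (sym eq) (wrap e)
... | steps l eq = subst (R _) (sym eq) (step l)

next< : ∀ {k x} → x < k → next k x < k
next< x<k = aroundCycle (λ _ y → y < _) (λ l → l) (λ e → subst (0 <_) e z<s) x<k

next-injective : ∀ {k x y} → x < k → y < k → next k x ≡ next k y → x ≡ y
next-injective x<k y<k eq with nextView x<k | nextView y<k
... | wraps a _ | wraps b _ = suc-injective (trans a (sym b))
... | wraps _ p | steps _ q = ⊥-elim (0≢1+n (trans (sym p) (trans eq q)))
... | steps _ p | wraps _ q = ⊥-elim (0≢1+n (trans (sym q) (trans (sym eq) p)))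
... | steps _ p | steps _ q = suc-injective (trans (sym p) (trans eq q))

tooShort : ∀ {k n} → 3 ≤ k → k ≡ n → n ≤ 2 → ⊥
tooShort 3≤k e n≤2 = <⇒≱ 3≤k (subst (_≤ 2) (sym e) n≤2)

next-irreflexive : ∀ {k x} → 3 ≤ k → x < k → next k x ≢ x
next-irreflexive 3≤k x<k e with nextView x<k
... | wraps a p = tooShort 3≤k (trans (sym a) (cong suc (trans (sym e) p))) (s≤s z≤n)
... | steps _ p = 1+n≢n (trans (sym p) e)

next-asymmetric : ∀ {k x y} → 3 ≤ k → x < k → y < k → next k x ≡ y → next k y ≢ x
next-asymmetric 3≤k x<k y<k e₁ e₂ with nextView x<k | nextView y<k
... | wraps a p | wraps _ q = tooShort 3≤k (trans (sym a) (cong suc (trans (sym e₂) q))) (s≤s z≤n)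
... | wraps a p | steps _ q =
  tooShort 3≤k (trans (sym a) (cong suc (trans (sym e₂) (trans q (cong suc (trans (sym e₁) p)))))) ≤-refl
... | steps _ p | wraps b q =
  tooShort 3≤k (trans (sym b) (cong suc (trans (sym e₁) (trans p (cong suc (trans (sym e₂) q)))))) ≤-refl
... | steps _ p | steps _ q = m≢1+n+m _ {1} (trans (sym e₂) (trans q (cong suc (trans (sym e₁) p))))

prev< : ∀ {k x} → x < k → prev k x < k
prev< {suc k} {zero}  _   = ≤-refl
prev< {k}     {suc x} x<k = <-trans (n<1+n x) x<k

next-prev : ∀ {k x} → x < k → next k (prev k x) ≡ x
next-prev {suc k} {zero}  _   with nextView {suc k} {k} ≤-refl
... | wraps _ p = p
... | steps l _ = ⊥-elim (<-irrefl refl l)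
next-prev {k}     {suc x} x<k = next-step x<k

cycSucc⇒next : ∀ {k} {i j : Fin k} → CycSucc k i j → toℕ j ≡ next k (toℕ i)
cycSucc⇒next {j = j} (inj₁ e) = trans e (sym (next-step (subst (_< _) e (toℕ<n j))))
cycSucc⇒next {k} {i} (inj₂ (e₁ , e₂)) with nextView (toℕ<n i)
... | wraps _ p = trans e₂ (sym p)
... | steps l _ = ⊥-elim (<-irrefl e₁ l)

next⇒cycSucc : ∀ {k} {i j : Fin k} → toℕ j ≡ next k (toℕ i) → CycSucc k i j
next⇒cycSucc {i = i} e with nextView (toℕ<n i)
... | wraps a p = inj₂ (a , trans e p)
... | steps _ p = inj₁ (trans e p)

successor : ∀ {k} (i : Fin k) → Σ (Fin k) λ i' → toℕ i' ≡ next k (toℕ i)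
successor i = fromℕ< (next< (toℕ<n i)) , toℕ-fromℕ< (next< (toℕ<n i))

predecessor : ∀ {k} (i : Fin k) → Σ (Fin k) λ i' → toℕ i ≡ next k (toℕ i')
predecessor {k} i = i' , sym (trans (cong (next k) (toℕ-fromℕ< lt)) (next-prev (toℕ<n i)))
  where lt : prev k (toℕ i) < k
        lt = prev< (toℕ<n i)
        i' : Fin k
        i' = fromℕ< lt

OneOf : ℕ → ℕ → ℕ → ℕ → ℕ → Set
OneOf k u d r l = k ≡ u ⊎ k ≡ d ⊎ k ≡ r ⊎ k ≡ l

record Perm4 (u d r l : ℕ) : Set where
  field
    bounded : u ≤ 3 × d ≤ 3 × r ≤ 3 × l ≤ 3
    u≢d : u ≢ d
    u≢r : u ≢ r
    u≢l : u ≢ l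
    d≢r : d ≢ r
    d≢l : d ≢ l
    r≢l : r ≢ l
    hits : OneOf 0 u d r l × OneOf 1 u d r l × OneOf 2 u d r l × OneOf 3 u d r l

  onto : ∀ k → k ≤ 3 → OneOf k u d r l
  onto 0 _ = proj₁ hits
  onto 1 _ = proj₁ (proj₂ hits)
  onto 2 _ = proj₁ (proj₂ (proj₂ hits))
  onto 3 _ = proj₂ (proj₂ (proj₂ hits))
  onto (suc (suc (suc (suc _)))) (s≤s (s≤s (s≤s ())))

-- Perm4 is decidable, so each concrete instance is checked by evaluation.
Perm4Conditions : ℕ → ℕ → ℕ → ℕ → Set
Perm4Conditions u d r l = (u ≤ 3 × d ≤ 3 × r ≤ 3 × l ≤ 3)
  × u ≢ d × u ≢ r × u ≢ l × d ≢ r × d ≢ l × r ≢ l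
  × OneOf 0 u d r l × OneOf 1 u d r l × OneOf 2 u d r l × OneOf 3 u d r l

perm4? : ∀ u d r l → Dec (Perm4 u d r l)
perm4? u d r l = map′ toPerm4 fromPerm4 conditions?
  where
    oneOf? : ∀ k → Dec (OneOf k u d r l)
    oneOf? k = k ≟ u ⊎-dec k ≟ d ⊎-dec k ≟ r ⊎-dec k ≟ l
    conditions? : Dec (Perm4Conditions u d r l)
    conditions? = (u ≤? 3 ×-dec d ≤? 3 ×-dec r ≤? 3 ×-dec l ≤? 3)
      ×-dec ¬? (u ≟ d) ×-dec ¬? (u ≟ r) ×-dec ¬? (u ≟ l)
      ×-dec ¬? (d ≟ r) ×-dec ¬? (d ≟ l) ×-dec ¬? (r ≟ l)
      ×-dec oneOf? 0 ×-dec oneOf? 1 ×-dec oneOf? 2 ×-dec oneOf? 3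
    toPerm4 : Perm4Conditions u d r l → Perm4 u d r l
    toPerm4 (b , ud , ur , ul , dr , dl , rl , h₀ , h₁ , h₂ , h₃) = record
      { bounded = b ; u≢d = ud ; u≢r = ur ; u≢l = ul ; d≢r = dr ; d≢l = dl ; r≢l = rl
      ; hits = h₀ , h₁ , h₂ , h₃ }
    fromPerm4 : Perm4 u d r l → Perm4Conditions u d r l
    fromPerm4 P = bounded , u≢d , u≢r , u≢l , d≢r , d≢l , r≢l , hits
      where open Perm4 P

perm4 : ∀ {u d r l} → {True (perm4? u d r l)} → Perm4 u d r l
perm4 {u} {d} {r} {l} {ok} = toWitness {a? = perm4? u d r l} ok

reach : ∀ {s k o} → s ≤ k → k ∸ s ≡ o → s + o ≡ k
reach s≤k refl = m+[n∸m]≡n s≤k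

-- The edge from (x,y) towards x+1 is
-- coloured base + up, towards x-1 base + down, towards y+1 base + right and towards
-- y-1 base + left; the two ends of every edge must agree, each vertex's window
-- [base, base+3] must lie in [1,t], and the windows must cover [1,t].
record Window (a b t : ℕ) : Set where
  field
    base : ℕ → ℕ → ℕ
    up down right left : ℕ → ℕ → ℕ
    up-down : ∀ x y → x < a → y < b →
      base x y + up x y ≡ base (next a x) y + down (next a x) y
    right-left : ∀ x y → x < a → y < b →
      base x y + right x y ≡ base x (next b y) + left x (next b y)
    offsets : ∀ x y → x < a → y < b → Perm4 (up x y) (down x y) (right x y) (left x y)
    bounded : ∀ x y → x < a → y < b → 1 ≤ base x y × base x y + 3 ≤ t
    covered : ∀ k → 1 ≤ k → k ≤ t →
      ∃[ x ] ∃[ y ] (x < a × y < b × base x y ≤ k × k ≤ base x y + 3)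

module WindowColouring {a b t : ℕ} (3≤a : 3 ≤ a) (3≤b : 3 ≤ b) (W : Window a b t) where
  open Window W

  V : Set
  V = Graph.V (Torus a b)

  Adj : V → V → Set
  Adj = Graph.Adj (Torus a b)

  colour : V → V → ℕ
  colour (i , j) (i' , j') = if does (toℕ j ≟ toℕ j')
    then (if does (toℕ i' ≟ next a x) then base x y + up x y else base x y + down x y)
    else (if does (toℕ j' ≟ next b y) then base x y + right x y else base x y + left x y)
    where x y : ℕ
          x = toℕ i
          y = toℕ j

  data Nb : V → V → Set where
    nU : ∀ {i i' j} → toℕ i' ≡ next a (toℕ i) → Nb (i , j) (i' , j)
    nD : ∀ {i i' j} → toℕ i ≡ next a (toℕ i') → Nb (i , j) (i' , j)
    nR : ∀ {i j j'} → toℕ j' ≡ next b (toℕ j) → Nb (i , j) (i , j')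
    nL : ∀ {i j j'} → toℕ j ≡ next b (toℕ j') → Nb (i , j) (i , j')

  classify : ∀ {u v} → Adj u v → Nb u v
  classify (inj₁ (refl , inj₁ s)) = nR (cycSucc⇒next s)
  classify (inj₁ (refl , inj₂ s)) = nL (cycSucc⇒next s)
  classify (inj₂ (refl , inj₁ s)) = nU (cycSucc⇒next s)
  classify (inj₂ (refl , inj₂ s)) = nD (cycSucc⇒next s)

  baseAt : V → ℕ
  baseAt (i , j) = base (toℕ i) (toℕ j)

  offsetsAt : (u : V) → let x = toℕ (proj₁ u) ; y = toℕ (proj₂ u) in
              Perm4 (up x y) (down x y) (right x y) (left x y)
  offsetsAt (i , j) = offsets (toℕ i) (toℕ j) (toℕ<n i) (toℕ<n j)

  offset : ∀ {u v} → Nb u v → ℕ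
  offset (nU {i} {_} {j} _) = up (toℕ i) (toℕ j)
  offset (nD {i} {_} {j} _) = down (toℕ i) (toℕ j)
  offset (nR {i} {j} _)     = right (toℕ i) (toℕ j)
  offset (nL {i} {j} _)     = left (toℕ i) (toℕ j)

  offset≤3 : ∀ {u v} (n : Nb u v) → offset n ≤ 3
  offset≤3 (nU {i} {_} {j} _) = proj₁ (Perm4.bounded (offsetsAt (i , j)))
  offset≤3 (nD {i} {_} {j} _) = proj₁ (proj₂ (Perm4.bounded (offsetsAt (i , j))))
  offset≤3 (nR {i} {j} _)     = proj₁ (proj₂ (proj₂ (Perm4.bounded (offsetsAt (i , j)))))
  offset≤3 (nL {i} {j} _)     = proj₂ (proj₂ (proj₂ (Perm4.bounded (offsetsAt (i , j)))))

  -- The colour of an edge seen from u is base u plus the offset of its direction;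
  -- since both cycles have length at least 3, the four directions are distinguishable.
  colour-Nb : ∀ {u v} (n : Nb u v) → colour u v ≡ baseAt u + offset n
  colour-Nb (nU {i} {i'} {j} e)
    rewrite dec-true (toℕ j ≟ toℕ j) refl | dec-true (toℕ i' ≟ next a (toℕ i)) e = refl
  colour-Nb (nD {i} {i'} {j} e)
    rewrite dec-true (toℕ j ≟ toℕ j) refl
          | dec-false (toℕ i' ≟ next a (toℕ i))
              (λ q → next-asymmetric 3≤a (toℕ<n i') (toℕ<n i) (sym e) (sym q)) = refl
  colour-Nb (nR {i} {j} {j'} e)
    rewrite dec-false (toℕ j ≟ toℕ j')
              (λ q → next-irreflexive 3≤b (toℕ<n j) (sym (trans q e)))
          | dec-true (toℕ j' ≟ next b (toℕ j)) e = refl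
  colour-Nb (nL {i} {j} {j'} e)
    rewrite dec-false (toℕ j ≟ toℕ j')
              (λ q → next-irreflexive 3≤b (toℕ<n j') (sym (trans (sym q) e)))
          | dec-false (toℕ j' ≟ next b (toℕ j))
              (λ q → next-asymmetric 3≤b (toℕ<n j') (toℕ<n j) (sym e) (sym q)) = refl

  verticalAgree : ∀ {i i' : Fin a} {j : Fin b} → toℕ i' ≡ next a (toℕ i) →
    baseAt (i , j) + up (toℕ i) (toℕ j) ≡ baseAt (i' , j) + down (toℕ i') (toℕ j)
  verticalAgree {i} {i'} {j} e =
    subst (λ z → baseAt (i , j) + up (toℕ i) (toℕ j) ≡ base z (toℕ j) + down z (toℕ j))
          (sym e) (up-down (toℕ i) (toℕ j) (toℕ<n i) (toℕ<n j))

  horizontalAgree : ∀ {i : Fin a} {j j' : Fin b} → toℕ j' ≡ next b (toℕ j) →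
    baseAt (i , j) + right (toℕ i) (toℕ j) ≡ baseAt (i , j') + left (toℕ i) (toℕ j')
  horizontalAgree {i} {j} {j'} e =
    subst (λ z → baseAt (i , j) + right (toℕ i) (toℕ j) ≡ base (toℕ i) z + left (toℕ i) z)
          (sym e) (right-left (toℕ i) (toℕ j) (toℕ<n i) (toℕ<n j))

  symm : ∀ u v → Adj u v → colour u v ≡ colour v u
  symm u v uv with classify uv
  ... | nU {i} {i'} {j} e =
    trans (colour-Nb (nU e)) (trans (verticalAgree e) (sym (colour-Nb (nD {i'} {i} {j} e))))
  ... | nD {i} {i'} {j} e =
    trans (colour-Nb (nD e)) (sym (trans (colour-Nb (nU {i'} {i} {j} e)) (verticalAgree e)))
  ... | nR {i} {j} {j'} e =
    trans (colour-Nb (nR e)) (trans (horizontalAgree e) (sym (colour-Nb (nL {i} {j'} {j} e))))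
  ... | nL {i} {j} {j'} e =
    trans (colour-Nb (nL e)) (sym (trans (colour-Nb (nR {i} {j'} {j} e)) (horizontalAgree e)))

  inWindow : ∀ u v → Adj u v → baseAt u ≤ colour u v × colour u v ≤ baseAt u + 3
  inWindow u v uv = subst (baseAt u ≤_) (sym (colour-Nb n)) (m≤m+n (baseAt u) (offset n))
                  , subst (_≤ baseAt u + 3) (sym (colour-Nb n)) (+-monoʳ-≤ (baseAt u) (offset≤3 n))
    where n : Nb u v
          n = classify uv

  range : ∀ u v → Adj u v → 1 ≤ colour u v × colour u v ≤ t
  range u@(i , j) v uv = ≤-trans (proj₁ inside) (proj₁ (inWindow u v uv))
                       , ≤-trans (proj₂ (inWindow u v uv)) (proj₂ inside)
    where inside : 1 ≤ baseAt u × baseAt u + 3 ≤ t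
          inside = bounded (toℕ i) (toℕ j) (toℕ<n i) (toℕ<n j)

  sameOffset : ∀ {u v w} (n₁ : Nb u v) (n₂ : Nb u w) → offset n₁ ≡ offset n₂ → v ≡ w
  sameOffset (nU e₁) (nU e₂) _ = cong (_, _) (toℕ-injective (trans e₁ (sym e₂)))
  sameOffset (nU {i} {_} {j} _) (nD _) q = ⊥-elim (Perm4.u≢d (offsetsAt (i , j)) q)
  sameOffset (nU {i} {_} {j} _) (nR _) q = ⊥-elim (Perm4.u≢r (offsetsAt (i , j)) q)
  sameOffset (nU {i} {_} {j} _) (nL _) q = ⊥-elim (Perm4.u≢l (offsetsAt (i , j)) q)
  sameOffset (nD {i} {_} {j} _) (nU _) q = ⊥-elim (Perm4.u≢d (offsetsAt (i , j)) (sym q))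
  sameOffset (nD {_} {i'} e₁) (nD {_} {i''} e₂) _ =
    cong (_, _) (toℕ-injective (next-injective (toℕ<n i') (toℕ<n i'') (trans (sym e₁) e₂)))
  sameOffset (nD {i} {_} {j} _) (nR _) q = ⊥-elim (Perm4.d≢r (offsetsAt (i , j)) q)
  sameOffset (nD {i} {_} {j} _) (nL _) q = ⊥-elim (Perm4.d≢l (offsetsAt (i , j)) q)
  sameOffset (nR {i} {j} _) (nU _) q = ⊥-elim (Perm4.u≢r (offsetsAt (i , j)) (sym q))
  sameOffset (nR {i} {j} _) (nD _) q = ⊥-elim (Perm4.d≢r (offsetsAt (i , j)) (sym q))
  sameOffset (nR e₁) (nR e₂) _ = cong (_ ,_) (toℕ-injective (trans e₁ (sym e₂)))
  sameOffset (nR {i} {j} _) (nL _) q = ⊥-elim (Perm4.r≢l (offsetsAt (i , j)) q)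
  sameOffset (nL {i} {j} _) (nU _) q = ⊥-elim (Perm4.u≢l (offsetsAt (i , j)) (sym q))
  sameOffset (nL {i} {j} _) (nD _) q = ⊥-elim (Perm4.d≢l (offsetsAt (i , j)) (sym q))
  sameOffset (nL {i} {j} _) (nR _) q = ⊥-elim (Perm4.r≢l (offsetsAt (i , j)) (sym q))
  sameOffset (nL {_} {_} {j'} e₁) (nL {_} {_} {j''} e₂) _ =
    cong (_ ,_) (toℕ-injective (next-injective (toℕ<n j') (toℕ<n j'') (trans (sym e₁) e₂)))

  proper : ∀ u v w → Adj u v → Adj u w → colour u v ≡ colour u w → v ≡ w
  proper u v w uv uw e = sameOffset n₁ n₂
    (+-cancelˡ-≡ (baseAt u) _ _ (trans (sym (colour-Nb n₁)) (trans e (colour-Nb n₂))))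
    where n₁ : Nb u v
          n₁ = classify uv
          n₂ : Nb u w
          n₂ = classify uw

  fillWindow : ∀ u k → baseAt u ≤ k → k ≤ baseAt u + 3 → ∃[ v ] (Adj u v × colour u v ≡ k)
  fillWindow u@(i , j) k s≤k k≤s+3
    with Perm4.onto (offsetsAt u) (k ∸ baseAt u) (m≤n+o⇒m∸n≤o k (baseAt u) k≤s+3)
  ... | inj₁ p = let (i' , e) = successor i in
    (i' , j) , inj₂ (refl , inj₁ (next⇒cycSucc e)) , trans (colour-Nb (nU {i} {i'} {j} e)) (reach s≤k p)
  ... | inj₂ (inj₁ p) = let (i' , e) = predecessor i in
    (i' , j) , inj₂ (refl , inj₂ (next⇒cycSucc e)) , trans (colour-Nb (nD {i} {i'} {j} e)) (reach s≤k p)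
  ... | inj₂ (inj₂ (inj₁ p)) = let (j' , e) = successor j in
    (i , j') , inj₁ (refl , inj₁ (next⇒cycSucc e)) , trans (colour-Nb (nR {i} {j} {j'} e)) (reach s≤k p)
  ... | inj₂ (inj₂ (inj₂ p)) = let (j' , e) = predecessor j in
    (i , j') , inj₁ (refl , inj₂ (next⇒cycSucc e)) , trans (colour-Nb (nL {i} {j} {j'} e)) (reach s≤k p)

  interval : ∀ u v w k → Adj u v → Adj u w → colour u v ≤ k → k ≤ colour u w →
             ∃[ x ] (Adj u x × colour u x ≡ k)
  interval u v w k uv uw l₁ l₂ = fillWindow u k (≤-trans (proj₁ (inWindow u v uv)) l₁)
                                               (≤-trans l₂ (proj₂ (inWindow u w uw)))

  allUsed : ∀ k → 1 ≤ k → k ≤ t → ∃[ u ] ∃[ v ] (Adj u v × colour u v ≡ k)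
  allUsed k 1≤k k≤t with covered k 1≤k k≤t
  ... | x , y , x<a , y<b , l₁ , l₂ = u , fillWindow u k (subst (_≤ k) (sym same) l₁)
                                                         (subst (λ z → k ≤ z + 3) (sym same) l₂)
    where u : V
          u = fromℕ< x<a , fromℕ< y<b
          same : baseAt u ≡ base x y
          same = cong₂ base (toℕ-fromℕ< x<a) (toℕ-fromℕ< y<b)

  windowColouring : HasIntervalColoring (Torus a b) t
  windowColouring = colour , record
    { symm = symm ; range = range ; allUsed = allUsed ; proper = proper ; interval = interval }

+-swapLast : ∀ p q r → p + q + r ≡ p + r + q
+-swapLast = solve-∀

windowChain : ∀ (w : ℕ) (g : ℕ → ℕ) L → (∀ l → l < L → g (suc l) ≤ g l + w) →
  ∀ k → g 0 ≤ k → k ≤ g L + w → ∃[ l ] (l ≤ L × g l ≤ k × k ≤ g l + w)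
windowChain w g zero    _     k l₁ l₂ = 0 , z≤n , l₁ , l₂
windowChain w g (suc L) grows k l₁ l₂ with g (suc L) ≤? k
... | yes p = suc L , ≤-refl , p , l₂
... | no ¬p =
  let (l , l≤L , p , q) = windowChain w g L (λ l l<L → grows l (m<n⇒m<1+n l<L)) k l₁ k≤end
  in l , m≤n⇒m≤1+n l≤L , p , q
  where k≤end : k ≤ g L + w
        k≤end = ≤-trans (<⇒≤ (≰⇒> ¬p)) (grows L ≤-refl)

riseBound : ∀ {s o s' o'} → s + o ≡ s' + o' → o ≤ 3 → s' ≤ s + 3
riseBound {s} {o} {s'} {o'} e o≤3 =
  ≤-trans (m≤m+n s' o') (≤-trans (≤-reflexive (sym e)) (+-monoʳ-≤ s o≤3))

-- Product profiles: the base colour of (x,y) is 1 + A x + B y.  Edge agreement then reduces to step equations of A around C_a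
-- (for each column) and of B around C_b.  The largest colour is attained at the
-- peak vertex, where A and B are maximal.
record Profiles (a b : ℕ) : Set where
  field
    A B : ℕ → ℕ
    up down : ℕ → ℕ → ℕ
    shift right left : ℕ → ℕ
    row-step : ∀ x y → x < a → A x + up x y ≡ A (next a x) + down (next a x) y
    col-step : ∀ y → y < b → B y + right y ≡ B (next b y) + left (next b y)
    offsets : ∀ x y → x < a → y < b →
      Perm4 (up x y) (down x y) (shift x + right y) (shift x + left y)
    A-origin : A 0 ≡ 0
    B-origin : B 0 ≡ 0
    peakRow peakCol : ℕ
    peakRow<a : peakRow < a
    peakCol<b : peakCol < b
    A≤peak : ∀ x → x < a → A x ≤ A peakRow
    B≤peak : ∀ y → y < b → B y ≤ B peakCol

  height : ℕ
  height = A peakRow + B peakCol + 4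

module ProductColouring {a b : ℕ} (3≤a : 3 ≤ a) (3≤b : 3 ≤ b) (P : Profiles a b) where
  open Profiles P

  0<b : 0 < b
  0<b = ≤-trans (s≤s z≤n) 3≤b

  base : ℕ → ℕ → ℕ
  base x y = suc (A x + B y)

  addColumn : ∀ p o p' o' c → p + o ≡ p' + o' → suc (p + c) + o ≡ suc (p' + c) + o'
  addColumn p o p' o' c e = begin
    suc (p + c) + o ≡⟨ cong suc (+-swapLast p c o) ⟩
    suc (p + o + c) ≡⟨ cong (λ z → suc (z + c)) e ⟩
    suc (p' + o' + c) ≡⟨ cong suc (+-swapLast p' o' c) ⟩
    suc (p' + c) + o' ∎
    where open ≡-Reasoning

  addRow : ∀ q o q' o' r δ → q + o ≡ q' + o' → suc (r + q) + (δ + o) ≡ suc (r + q') + (δ + o')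
  addRow q o q' o' r δ e = cong suc (begin
    r + q + (δ + o)   ≡⟨ rearrange r q δ o ⟩
    r + δ + (q + o)   ≡⟨ cong (r + δ +_) e ⟩
    r + δ + (q' + o') ≡⟨ sym (rearrange r q' δ o') ⟩
    r + q' + (δ + o') ∎)
    where open ≡-Reasoning
          rearrange : ∀ r q δ o → r + q + (δ + o) ≡ r + δ + (q + o)
          rearrange = solve-∀

  up≤3 : ∀ x y → x < a → y < b → up x y ≤ 3
  up≤3 x y x<a y<b = proj₁ (Perm4.bounded (offsets x y x<a y<b))

  right≤3 : ∀ x y → x < a → y < b → right y ≤ 3
  right≤3 x y x<a y<b =
    m+n≤o⇒n≤o (shift x) (proj₁ (proj₂ (proj₂ (Perm4.bounded (offsets x y x<a y<b)))))

  rowChain : ∀ x → x < peakRow → A (suc x) + B 0 ≤ A x + B 0 + 3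
  rowChain x x<p = ≤-trans (+-monoˡ-≤ (B 0) rise) (≤-reflexive (+-swapLast (A x) 3 (B 0)))
    where sx<a : suc x < a
          sx<a = <-≤-trans (s≤s x<p) peakRow<a
          rise : A (suc x) ≤ A x + 3
          rise = riseBound (subst (λ z → A x + up x 0 ≡ A z + down z 0) (next-step sx<a)
                                  (row-step x 0 (<-trans (n<1+n x) sx<a)))
                           (up≤3 x 0 (<-trans (n<1+n x) sx<a) 0<b)

  colChain : ∀ y → y < peakCol → A peakRow + B (suc y) ≤ A peakRow + B y + 3
  colChain y y<p = ≤-trans (+-monoʳ-≤ (A peakRow) rise) (≤-reflexive (sym (+-assoc (A peakRow) (B y) 3)))
    where sy<b : suc y < b
          sy<b = <-≤-trans (s≤s y<p) peakCol<b
          y<b : y < b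
          y<b = <-trans (n<1+n y) sy<b
          rise : B (suc y) ≤ B y + 3
          rise = riseBound (subst (λ z → B y + right y ≡ B z + left z) (next-step sy<b) (col-step y y<b))
                           (right≤3 peakRow y peakRow<a y<b)

  -- Every k ≤ A peakRow + B peakCol + 3 lies in a window [A x + B y, A x + B y + 3]:
  -- first climb column 0 up to the peak row, then walk along the peak row.
  InWindow : ℕ → Set
  InWindow k = ∃[ x ] ∃[ y ] (x < a × y < b × A x + B y ≤ k × k ≤ A x + B y + 3)

  coverShifted : ∀ k → k ≤ A peakRow + B peakCol + 3 → InWindow k
  coverShifted k k≤top with k ≤? A peakRow + B 0 + 3
  ... | yes k≤mid =
    let (x , x≤p , l₁ , l₂) = windowChain 3 (λ x → A x + B 0) peakRow rowChain k start k≤mid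
    in x , 0 , ≤-<-trans x≤p peakRow<a , 0<b , l₁ , l₂
    where start : A 0 + B 0 ≤ k
          start = ≤-trans (≤-reflexive (cong₂ _+_ A-origin B-origin)) z≤n
  ... | no ¬k≤mid =
    let (y , y≤p , l₁ , l₂) = windowChain 3 (λ y → A peakRow + B y) peakCol colChain k start k≤top
    in peakRow , y , peakRow<a , ≤-<-trans y≤p peakCol<b , l₁ , l₂
    where start : A peakRow + B 0 ≤ k
          start = ≤-trans (m≤m+n _ 3) (<⇒≤ (≰⇒> ¬k≤mid))

  window : Window a b height
  window = record
    { base = base
    ; up = up
    ; down = down
    ; right = λ x y → shift x + right y
    ; left = λ x y → shift x + left y
    ; up-down = λ x y x<a _ → addColumn _ (up x y) _ (down (next a x) y) (B y) (row-step x y x<a)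
    ; right-left = λ x y _ y<b → addRow (B y) (right y) _ (left (next b y)) (A x) (shift x) (col-step y y<b)
    ; offsets = offsets
    ; bounded = λ x y x<a y<b → s≤s z≤n ,
        ≤-trans (≤-reflexive (sym (+-suc (A x + B y) 3)))
                (+-monoˡ-≤ 4 (+-mono-≤ (A≤peak x x<a) (B≤peak y y<b)))
    ; covered = covered
    }
    where
      covered : ∀ k → 1 ≤ k → k ≤ height →
        ∃[ x ] ∃[ y ] (x < a × y < b × base x y ≤ k × k ≤ base x y + 3)
      covered (suc k) _ k<height =
        let (x , y , x<a , y<b , l₁ , l₂) = coverShifted k (≤-pred (subst (suc k ≤_) (+-suc _ 3) k<height))
        in x , y , x<a , y<b , s≤s l₁ , s≤s l₂

  productColouring : HasIntervalColoring (Torus a b) height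
  productColouring = WindowColouring.windowColouring 3≤a 3≤b window

swapAdj : ∀ {a b} {u v : Graph.V (Torus a b)} →
  Graph.Adj (Torus a b) u v → Graph.Adj (Torus b a) (swap u) (swap v)
swapAdj {u = _ , _} {v = _ , _} (inj₁ e) = inj₂ e
swapAdj {u = _ , _} {v = _ , _} (inj₂ e) = inj₁ e

swapColouring : ∀ {a b t} → HasIntervalColoring (Torus a b) t → HasIntervalColoring (Torus b a) t
swapColouring (c , isColouring) = (λ u v → c (swap u) (swap v)) , record
  { symm = λ u v uv → symm (swap u) (swap v) (swapAdj uv)
  ; range = λ u v uv → range (swap u) (swap v) (swapAdj uv)
  ; allUsed = λ k 1≤k k≤t → let (u , v , uv , e) = allUsed k 1≤k k≤t in swap u , swap v , swapAdj uv , e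
  ; proper = λ u v w uv uw e → cong swap (proper (swap u) (swap v) (swap w) (swapAdj uv) (swapAdj uw) e)
  ; interval = λ u v w k uv uw l₁ l₂ →
      let (x , ux , e) = interval (swap u) (swap v) (swap w) k (swapAdj uv) (swapAdj uw) l₁ l₂
      in swap x , swapAdj ux , e
  }
  where open IsIntervalColoring isColouring

W≥-swap : ∀ {a b N} → W≥ (Torus a b) N → W≥ (Torus b a) N
W≥-swap (t , N≤t , c) = t , N≤t , swapColouring c

W≥-⊔ : ∀ {G M N} → W≥ G M → W≥ G N → W≥ G (M ⊔ N)
W≥-⊔ {M = M} {N} (t₁ , M≤t₁ , c₁) (t₂ , N≤t₂ , c₂) with ≤-total M N
... | inj₁ M≤N = t₂ , subst (_≤ t₂) (sym (m≤n⇒m⊔n≡n M≤N)) N≤t₂ , c₂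
... | inj₂ N≤M = t₁ , subst (_≤ t₁) (sym (m≥n⇒m⊔n≡m N≤M)) M≤t₁ , c₁

twice : ∀ m → 2 * m ≡ m + m
twice = solve-∀

3≤twice : ∀ {m} → 2 ≤ m → 3 ≤ 2 * m
3≤twice 2≤m = ≤-trans (n≤1+n 3) (*-monoʳ-≤ 2 2≤m)

∸-step : ∀ {N x} → x < N → N ∸ x ≡ suc (N ∸ suc x)
∸-step lt = +-∸-assoc 1 lt

reflect-middle : ∀ k → 2 * suc k ∸ suc (suc k) ≡ k
reflect-middle k = trans (cong (_∸ suc (suc k)) (spread k)) (m+n∸m≡n (suc (suc k)) k)
  where spread : ∀ k → 2 * suc k ≡ suc (suc k) + k
        spread = solve-∀

last-upper : ∀ {m x d} → d ≤ m → d + x ≡ 2 * m → m ≤ x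
last-upper {m} {x} {d} d≤m e = +-cancelˡ-≤ m m x (begin
  m + m   ≡⟨ sym (twice m) ⟩
  2 * m   ≡⟨ sym e ⟩
  d + x   ≤⟨ +-monoˡ-≤ x d≤m ⟩
  m + x   ∎)
  where open ≤-Reasoning

data RowKind : Set where
  first ascending turning descending : RowKind

upOffset downOffset rowShift : RowKind → ℕ
upOffset first      = 3
upOffset ascending  = 3
upOffset turning    = 0
upOffset descending = 0
downOffset first      = 2
downOffset ascending  = 0
downOffset turning    = 1
downOffset descending = 3
rowShift first      = 0
rowShift ascending  = 1
rowShift turning    = 2
rowShift descending = 1

bit : Bool → ℕ
bit true  = 1
bit false = 0

evenOffsets : ∀ r h → Perm4 (upOffset r) (downOffset r) (rowShift r + bit h) (rowShift r + bit (not h))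
evenOffsets first      true  = perm4
evenOffsets first      false = perm4
evenOffsets ascending  true  = perm4
evenOffsets ascending  false = perm4
evenOffsets turning    true  = perm4
evenOffsets turning    false = perm4
evenOffsets descending true  = perm4
evenOffsets descending false = perm4

module EvenTorus (p q : ℕ) where
  m n a b : ℕ
  m = suc (suc p)
  n = suc (suc q)
  a = 2 * m
  b = 2 * n

  kind : ℕ → RowKind
  kind zero    = first
  kind (suc x) = if does (suc x <? m) then ascending else (if does (suc x ≟ m) then turning else descending)

  A : ℕ → ℕ
  A x = if does (x <? m) then 3 * x else 2 + 3 * (a ∸ suc x)

  leftHalf : ℕ → Bool
  leftHalf y = does (y <? n)

  B : ℕ → ℕ
  B y = if leftHalf y then y else b ∸ suc y

  A-asc : ∀ {x} → x < m → A x ≡ 3 * x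
  A-asc {x} lt rewrite dec-true (x <? m) lt = refl

  A-desc : ∀ {x} → m ≤ x → A x ≡ 2 + 3 * (a ∸ suc x)
  A-desc {x} le rewrite dec-false (x <? m) (≤⇒≯ le) = refl

  kind-asc : ∀ {x} → suc x < m → kind (suc x) ≡ ascending
  kind-asc {x} lt rewrite dec-true (suc x <? m) lt = refl

  kind-turn : kind m ≡ turning
  kind-turn rewrite dec-false (m <? m) (<-irrefl refl) | dec-true (m ≟ m) refl = refl

  kind-desc : ∀ {x} → m < suc x → kind (suc x) ≡ descending
  kind-desc {x} lt rewrite dec-false (suc x <? m) (<⇒≯ lt) | dec-false (suc x ≟ m) (>⇒≢ lt) = refl

  up-late : ∀ {x} → m ≤ suc x → upOffset (kind (suc x)) ≡ 0
  up-late {x} le rewrite dec-false (suc x <? m) (≤⇒≯ le) with does (suc x ≟ m)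
  ... | true  = refl
  ... | false = refl

  RowStep : ℕ → ℕ → Set
  RowStep x x' = A x + upOffset (kind x) ≡ A x' + downOffset (kind x')

  ascendingStep : ∀ {x} → suc (suc x) < m → RowStep (suc x) (suc (suc x))
  ascendingStep {x} lt
    rewrite A-asc (<-trans (n<1+n _) lt) | A-asc lt | kind-asc (<-trans (n<1+n _) lt) | kind-asc lt =
    arith x
    where arith : ∀ x → 3 * suc x + 3 ≡ 3 * suc (suc x) + 0
          arith = solve-∀

  turningStep : RowStep (suc p) m
  turningStep rewrite A-asc {suc p} ≤-refl | kind-asc {p} ≤-refl | A-desc {m} ≤-refl | kind-turn
                    | reflect-middle (suc p) = arith p
    where arith : ∀ p → 3 * suc p + 3 ≡ 2 + 3 * suc p + 1
          arith = solve-∀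

  descendingStep : ∀ {x} → m ≤ suc x → suc (suc x) < a → RowStep (suc x) (suc (suc x))
  descendingStep {x} le lt
    rewrite A-desc le | A-desc (m≤n⇒m≤1+n le) | up-late le | kind-desc (s≤s le) | ∸-step lt =
    arith (a ∸ suc (suc (suc x)))
    where arith : ∀ d → 2 + 3 * suc d + 0 ≡ 2 + 3 * d + 3
          arith = solve-∀

  rowInterior : ∀ {x} → suc x < a → RowStep x (suc x)
  rowInterior {zero}  _ = refl
  rowInterior {suc x} sx<a with <-cmp (suc (suc x)) m
  ... | tri< lt _ _ = ascendingStep lt
  ... | tri≈ _ e _  = subst (λ z → RowStep (suc z) (suc (suc z))) (sym (suc-injective (suc-injective e))) turningStep
  ... | tri> _ _ gt = descendingStep (≤-pred gt) sx<a

  rowWrap : ∀ {x} → suc x ≡ a → RowStep x 0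
  rowWrap {zero} ()
  rowWrap {suc x} e rewrite A-desc (last-upper (s≤s z≤n) e) | up-late (last-upper (s≤s z≤n) e)
                          | trans (cong (a ∸_) e) (n∸n≡0 a) = refl

  rowStep : ∀ {x} → x < a → RowStep x (next a x)
  rowStep = aroundCycle RowStep rowInterior rowWrap

  ColStep : ℕ → ℕ → Set
  ColStep y y' = B y + bit (leftHalf y) ≡ B y' + bit (not (leftHalf y'))

  colInterior : ∀ {y} → suc y < b → ColStep y (suc y)
  colInterior {y} sy<b with <-cmp (suc y) n
  ... | tri< lt _ _ rewrite dec-true (y <? n) (<-trans (n<1+n y) lt) | dec-true (suc y <? n) lt =
    trans (+-comm y 1) (sym (+-identityʳ (suc y)))
  ... | tri≈ _ e _  = subst (λ z → ColStep z (suc z)) (sym (suc-injective e)) middle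
    where middle : ColStep (suc q) n
          middle rewrite dec-true (suc q <? n) ≤-refl | dec-false (n <? n) (<-irrefl refl)
                       | reflect-middle (suc q) = refl
  ... | tri> _ _ gt rewrite dec-false (y <? n) (≤⇒≯ (≤-pred gt)) | dec-false (suc y <? n) (<⇒≯ gt)
                          | ∸-step sy<b = trans (+-identityʳ _) (+-comm 1 (b ∸ suc (suc y)))

  colWrap : ∀ {y} → suc y ≡ b → ColStep y 0
  colWrap {y} e rewrite dec-false (y <? n) (≤⇒≯ (last-upper (s≤s z≤n) e))
                      | trans (cong (b ∸_) e) (n∸n≡0 b) = refl

  colStep : ∀ {y} → y < b → ColStep y (next b y)
  colStep = aroundCycle ColStep colInterior colWrap

  A-peak : A m ≡ 2 + 3 * suc p
  A-peak = trans (A-desc ≤-refl) (cong (λ z → 2 + 3 * z) (reflect-middle (suc p)))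

  A≤peak : ∀ x → x < a → A x ≤ A m
  A≤peak x x<a with x <? m
  ... | yes lt = begin
    A x          ≡⟨ A-asc lt ⟩
    3 * x        ≤⟨ *-monoʳ-≤ 3 (≤-pred lt) ⟩
    3 * suc p    ≤⟨ m≤n+m _ 2 ⟩
    2 + 3 * suc p ≡⟨ sym A-peak ⟩
    A m          ∎
    where open ≤-Reasoning
  ... | no ¬lt = begin
    A x                   ≡⟨ A-desc (≮⇒≥ ¬lt) ⟩
    2 + 3 * (a ∸ suc x)   ≤⟨ +-monoʳ-≤ 2 (*-monoʳ-≤ 3 (∸-monoʳ-≤ a (s≤s (≮⇒≥ ¬lt)))) ⟩
    2 + 3 * (a ∸ suc m)   ≡⟨ sym (A-desc ≤-refl) ⟩
    A m                   ∎
    where open ≤-Reasoning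

  B-peak : B (suc q) ≡ suc q
  B-peak rewrite dec-true (suc q <? n) ≤-refl = refl

  B≤peak : ∀ y → y < b → B y ≤ B (suc q)
  B≤peak y y<b with y <? n
  ... | yes lt = begin
    B y       ≡⟨ B-left ⟩
    y         ≤⟨ ≤-pred lt ⟩
    suc q     ≡⟨ sym B-peak ⟩
    B (suc q) ∎
    where open ≤-Reasoning
          B-left : B y ≡ y
          B-left rewrite dec-true (y <? n) lt = refl
  ... | no ¬lt = begin
    B y           ≡⟨ B-right ⟩
    b ∸ suc y     ≤⟨ ∸-monoʳ-≤ b (s≤s (≮⇒≥ ¬lt)) ⟩
    b ∸ suc n     ≡⟨ reflect-middle (suc q) ⟩
    suc q         ≡⟨ sym B-peak ⟩
    B (suc q)     ∎
    where open ≤-Reasoning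
          B-right : B y ≡ b ∸ suc y
          B-right rewrite dec-false (y <? n) ¬lt = refl

  profiles : Profiles a b
  profiles = record
    { A = A ; B = B
    ; up = λ x _ → upOffset (kind x)
    ; down = λ x _ → downOffset (kind x)
    ; shift = λ x → rowShift (kind x)
    ; right = λ y → bit (leftHalf y)
    ; left = λ y → bit (not (leftHalf y))
    ; row-step = λ x _ x<a → rowStep x<a
    ; col-step = λ y y<b → colStep y<b
    ; offsets = λ x y _ _ → evenOffsets (kind x) (leftHalf y)
    ; A-origin = refl
    ; B-origin = refl
    ; peakRow = m
    ; peakCol = suc q
    ; peakRow<a = m<m+n m {m + 0} (s≤s z≤n)
    ; peakCol<b = m≤m+n n (n + 0)
    ; A≤peak = A≤peak
    ; B≤peak = B≤peak
    }

  colours : 3 * m + n + 2 ≡ Profiles.height profiles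
  colours = trans (arith p q) (sym (cong₂ (λ u v → u + v + 4) A-peak B-peak))
    where arith : ∀ p q → 3 * suc (suc p) + suc (suc q) + 2 ≡ 2 + 3 * suc p + suc q + 4
          arith = solve-∀

  lowerBound : W≥ (Torus a b) (3 * m + n + 2)
  lowerBound = Profiles.height profiles , ≤-reflexive colours
             , ProductColouring.productColouring (3≤twice (s≤s (s≤s z≤n))) (3≤twice (s≤s (s≤s z≤n))) profiles

-- The row potential of the odd tori: the sequence 0,3,4,7,8,… , i.e. 2k plus the
-- parity of k; its increments alternate between 3 and 1.
odd : ℕ → Bool
odd zero          = false
odd (suc zero)    = true
odd (suc (suc k)) = odd k

odd-suc : ∀ k → odd (suc k) ≡ not (odd k)
odd-suc zero          = refl
odd-suc (suc zero)    = refl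
odd-suc (suc (suc k)) = odd-suc k

ascent : ℕ → ℕ
ascent k = 2 * k + bit (odd k)

ascent-step : ∀ k → ascent (suc k) ≡ ascent k + (if odd k then 1 else 3)
ascent-step k rewrite odd-suc k with odd k
... | true  = arith k
  where arith : ∀ k → 2 * suc k + 0 ≡ 2 * k + 1 + 1
        arith = solve-∀
... | false = arith k
  where arith : ∀ k → 2 * suc k + 1 ≡ 2 * k + 0 + 3
        arith = solve-∀

ascent-mono : ∀ {k k'} → k ≤ k' → ascent k ≤ ascent k'
ascent-mono {k' = zero} z≤n = ≤-refl
ascent-mono {k} {suc k'} le with m≤n⇒m<n∨m≡n le
... | inj₂ refl = ≤-refl
... | inj₁ lt   = ≤-trans (ascent-mono (≤-pred lt))
                          (subst (ascent k' ≤_) (sym (ascent-step k')) (m≤m+n _ _))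

data Phase : Set where
  ascEven ascOdd descEven descOdd : Phase

data ColKind : Set where
  col0 colRise colTop colFall : ColKind

-- The vertical offsets of the odd tori depend on the column kind through colGap;
-- colRight and colLeft are the horizontal offsets before the phase shift.
colGap colRight colLeft : ColKind → ℕ
colGap col0    = 0
colGap colRise = 1
colGap colTop  = 2
colGap colFall = 1
colRight col0    = 1
colRight colRise = 2
colRight colTop  = 0
colRight colFall = 0
colLeft col0    = 2
colLeft colRise = 0
colLeft colTop  = 1
colLeft colFall = 2

phaseUp phaseDown : Phase → ColKind → ℕ
phaseUp ascEven  c = 3
phaseUp ascOdd   c = suc (colGap c)
phaseUp descEven c = colGap c
phaseUp descOdd  c = 0
phaseDown ascEven  c = colGap c
phaseDown ascOdd   c = 0
phaseDown descEven c = 3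
phaseDown descOdd  c = suc (colGap c)

phaseShift : Phase → ℕ
phaseShift ascEven  = 0
phaseShift ascOdd   = 1
phaseShift descEven = 0
phaseShift descOdd  = 1

oddOffsets : ∀ r c → Perm4 (phaseUp r c) (phaseDown r c) (phaseShift r + colRight c) (phaseShift r + colLeft c)
oddOffsets ascEven  col0    = perm4
oddOffsets ascEven  colRise = perm4
oddOffsets ascEven  colTop  = perm4
oddOffsets ascEven  colFall = perm4
oddOffsets ascOdd   col0    = perm4
oddOffsets ascOdd   colRise = perm4
oddOffsets ascOdd   colTop  = perm4
oddOffsets ascOdd   colFall = perm4
oddOffsets descEven col0    = perm4
oddOffsets descEven colRise = perm4
oddOffsets descEven colTop  = perm4
oddOffsets descEven colFall = perm4
oddOffsets descOdd  col0    = perm4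
oddOffsets descOdd  colRise = perm4
oddOffsets descOdd  colTop  = perm4
oddOffsets descOdd  colFall = perm4

ascPhase descPhase : Bool → Phase
ascPhase b  = if b then ascOdd else ascEven
descPhase b = if b then descOdd else descEven

-- The three kinds of row steps, for every column kind c, stated for consecutive
-- terms F, F' of the ascent whose index has parity o: along the ascending side,
-- across the middle (both rows have the same index), and along the descending side.
shiftOne : ∀ F g → F + suc g ≡ F + 1 + g
shiftOne = solve-∀

ascendingPhaseStep : ∀ {F F' o'} o c → o' ≡ not o → F' ≡ F + (if o then 1 else 3) →
  F + phaseUp (ascPhase o) c ≡ F' + phaseDown (ascPhase o') c
ascendingPhaseStep true  c refl refl = shiftOne _ (colGap c)
ascendingPhaseStep false c refl refl = sym (+-identityʳ _)

turningPhaseStep : ∀ F o c → F + phaseUp (ascPhase o) c ≡ F + phaseDown (descPhase o) c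
turningPhaseStep F true  c = refl
turningPhaseStep F false c = refl

descendingPhaseStep : ∀ {F F' o'} o c → o' ≡ not o → F' ≡ F + (if o then 1 else 3) →
  F' + phaseUp (descPhase o') c ≡ F + phaseDown (descPhase o) c
descendingPhaseStep true  c refl refl = sym (shiftOne _ (colGap c))
descendingPhaseStep false c refl refl = +-identityʳ _

module OddTorus (p q : ℕ) where
  m n a b : ℕ
  m = suc (suc p)
  n = suc q
  a = 2 * m
  b = 2 * n + 1

  phase : ℕ → Phase
  phase zero    = descEven
  phase (suc k) = if does (suc k ≤? m) then ascPhase (odd k) else descPhase (odd (a ∸ suc k))

  A : ℕ → ℕ
  A zero    = 0
  A (suc k) = if does (suc k ≤? m) then ascent k else ascent (a ∸ suc k)

  colKind : ℕ → ColKind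
  colKind zero    = col0
  colKind (suc k) = if does (suc k ≤? n) then colRise else (if does (k ≟ n) then colTop else colFall)

  B : ℕ → ℕ
  B zero    = 0
  B (suc k) = if does (suc k ≤? n) then suc k + k else 2 * (b ∸ suc k)

  A-asc : ∀ {k} → suc k ≤ m → A (suc k) ≡ ascent k
  A-asc {k} le rewrite dec-true (suc k ≤? m) le = refl

  A-desc : ∀ {k} → m < suc k → A (suc k) ≡ ascent (a ∸ suc k)
  A-desc {k} lt rewrite dec-false (suc k ≤? m) (<⇒≱ lt) = refl

  phase-asc : ∀ {k} → suc k ≤ m → phase (suc k) ≡ ascPhase (odd k)
  phase-asc {k} le rewrite dec-true (suc k ≤? m) le = refl

  phase-desc : ∀ {k} → m < suc k → phase (suc k) ≡ descPhase (odd (a ∸ suc k))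
  phase-desc {k} lt rewrite dec-false (suc k ≤? m) (<⇒≱ lt) = refl

  RowStep : ℕ → ℕ → Set
  RowStep x x' = ∀ c → A x + phaseUp (phase x) c ≡ A x' + phaseDown (phase x') c

  ascendingStep : ∀ {k} → suc k < m → RowStep (suc k) (suc (suc k))
  ascendingStep {k} lt c rewrite A-asc (<⇒≤ lt) | A-asc lt | phase-asc (<⇒≤ lt) | phase-asc lt =
    ascendingPhaseStep (odd k) c (odd-suc k) (ascent-step k)

  turningStep : RowStep m (suc m)
  turningStep c rewrite A-asc {suc p} ≤-refl | phase-asc {suc p} ≤-refl | A-desc {m} ≤-refl
                      | phase-desc {m} ≤-refl | reflect-middle (suc p) =
    turningPhaseStep (ascent (suc p)) (odd (suc p)) c

  descendingStep : ∀ {k} → m < suc k → suc (suc k) < a → RowStep (suc k) (suc (suc k))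
  descendingStep {k} gt lt c
    rewrite A-desc gt | A-desc (m<n⇒m<1+n gt) | phase-desc gt | phase-desc (m<n⇒m<1+n gt) =
    descendingPhaseStep (odd d) c (trans (cong odd reflect) (odd-suc d))
                                  (trans (cong ascent reflect) (ascent-step d))
    where d : ℕ
          d = a ∸ suc (suc k)
          reflect : a ∸ suc k ≡ suc d
          reflect = ∸-step (<-trans (n<1+n (suc k)) lt)

  rowInterior : ∀ {x} → suc x < a → RowStep x (suc x)
  rowInterior {zero}  _ c = refl
  rowInterior {suc k} sx<a with <-cmp (suc k) m
  ... | tri< lt _ _ = ascendingStep lt
  ... | tri≈ _ e _  = subst (λ z → RowStep z (suc z)) (sym e) turningStep
  ... | tri> _ _ gt = descendingStep gt sx<a

  rowWrap : ∀ {x} → suc x ≡ a → RowStep x 0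
  rowWrap {zero} ()
  rowWrap {suc k} e c rewrite A-desc (s≤s (last-upper (s≤s (s≤s z≤n)) e))
                            | phase-desc (s≤s (last-upper (s≤s (s≤s z≤n)) e))
                            | trans (cong (_∸ suc k) (sym e)) (m+n∸n≡m 1 (suc k)) = refl

  rowStep : ∀ {x} → x < a → RowStep x (next a x)
  rowStep = aroundCycle RowStep rowInterior rowWrap

  B-rise : ∀ {k} → suc k ≤ n → B (suc k) ≡ suc k + k
  B-rise {k} le rewrite dec-true (suc k ≤? n) le = refl

  B-fall : ∀ {k} → n < suc k → B (suc k) ≡ 2 * (b ∸ suc k)
  B-fall {k} lt rewrite dec-false (suc k ≤? n) (<⇒≱ lt) = refl

  kind-rise : ∀ {k} → suc k ≤ n → colKind (suc k) ≡ colRise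
  kind-rise {k} le rewrite dec-true (suc k ≤? n) le = refl

  kind-top : colKind (suc n) ≡ colTop
  kind-top rewrite dec-false (suc n ≤? n) (<-irrefl refl) | dec-true (n ≟ n) refl = refl

  kind-fall : ∀ {k} → suc n < suc k → colKind (suc k) ≡ colFall
  kind-fall {k} lt rewrite dec-false (suc k ≤? n) (<⇒≱ (<-trans (n<1+n n) lt))
                         | dec-false (k ≟ n) (>⇒≢ (≤-pred lt)) = refl

  right-late : ∀ {k} → n < suc k → colRight (colKind (suc k)) ≡ 0
  right-late {k} lt rewrite dec-false (suc k ≤? n) (<⇒≱ lt) with does (k ≟ n)
  ... | true  = refl
  ... | false = refl

  spread : b ≡ suc n + n
  spread = arith q
    where arith : ∀ q → 2 * suc q + 1 ≡ suc (suc q) + suc q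
          arith = solve-∀

  reflect-top : b ∸ suc n ≡ n
  reflect-top = trans (cong (_∸ suc n) spread) (m+n∸m≡n (suc n) n)

  3≤b : 3 ≤ b
  3≤b = +-monoˡ-≤ 1 (*-monoʳ-≤ 2 (s≤s z≤n))

  ColStep : ℕ → ℕ → Set
  ColStep y y' = B y + colRight (colKind y) ≡ B y' + colLeft (colKind y')

  topStep : ColStep n (suc n)
  topStep rewrite B-rise {q} ≤-refl | kind-rise {q} ≤-refl | B-fall {n} ≤-refl | kind-top | reflect-top =
    arith q
    where arith : ∀ q → suc q + q + 2 ≡ 2 * suc q + 1
          arith = solve-∀

  colInterior : ∀ {y} → suc y < b → ColStep y (suc y)
  colInterior {zero}  _ = refl
  colInterior {suc k} sy<b with <-cmp (suc k) n
  ... | tri< lt _ _ rewrite B-rise (<⇒≤ lt) | B-rise lt | kind-rise (<⇒≤ lt) | kind-rise lt = arith k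
    where arith : ∀ k → suc k + k + 2 ≡ suc (suc k) + suc k + 0
          arith = solve-∀
  ... | tri≈ _ e _  = subst (λ z → ColStep z (suc z)) (sym e) topStep
  ... | tri> _ _ gt rewrite B-fall gt | B-fall (m<n⇒m<1+n gt) | right-late gt | kind-fall (s≤s gt) =
    trans (cong (λ z → 2 * z + 0) (∸-step (<-trans (n<1+n (suc k)) sy<b))) (arith (b ∸ suc (suc k)))
    where arith : ∀ d → 2 * suc d + 0 ≡ 2 * d + 2
          arith = solve-∀

  colWrap : ∀ {y} → suc y ≡ b → ColStep y 0
  colWrap {zero}  e = ⊥-elim (tooShort 3≤b (sym e) (s≤s z≤n))
  colWrap {suc k} e rewrite B-fall (s≤s (last-upper (s≤s z≤n) (suc-injective (trans e (+-comm (2 * n) 1)))))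
                          | right-late (s≤s (last-upper (s≤s z≤n) (suc-injective (trans e (+-comm (2 * n) 1)))))
                          | trans (cong (_∸ suc k) (sym e)) (m+n∸n≡m 1 (suc k)) = refl

  colStep : ∀ {y} → y < b → ColStep y (next b y)
  colStep = aroundCycle ColStep colInterior colWrap

  A-peak : A m ≡ ascent (suc p)
  A-peak = A-asc ≤-refl

  A≤peak : ∀ x → x < a → A x ≤ A m
  A≤peak zero    _ = z≤n
  A≤peak (suc k) _ with suc k ≤? m
  ... | yes le = begin
    A (suc k)        ≡⟨ A-asc le ⟩
    ascent k         ≤⟨ ascent-mono (≤-pred le) ⟩
    ascent (suc p)   ≡⟨ sym A-peak ⟩
    A m              ∎
    where open ≤-Reasoning
  ... | no ¬le = begin
    A (suc k)             ≡⟨ A-desc (≰⇒> ¬le) ⟩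
    ascent (a ∸ suc k)    ≤⟨ ascent-mono (∸-monoʳ-≤ a (≰⇒> ¬le)) ⟩
    ascent (a ∸ suc m)    ≡⟨ cong ascent (reflect-middle (suc p)) ⟩
    ascent (suc p)        ≡⟨ sym A-peak ⟩
    A m                   ∎
    where open ≤-Reasoning

  B-peak : B (suc n) ≡ 2 * n
  B-peak = trans (B-fall ≤-refl) (cong (2 *_) reflect-top)

  B≤peak : ∀ y → y < b → B y ≤ B (suc n)
  B≤peak zero    _ = z≤n
  B≤peak (suc k) _ with suc k ≤? n
  ... | yes le = begin
    B (suc k)        ≡⟨ B-rise le ⟩
    suc k + k        ≤⟨ +-mono-≤ le (≤-trans (n≤1+n k) le) ⟩
    n + n            ≡⟨ sym (twice n) ⟩
    2 * n            ≡⟨ sym B-peak ⟩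
    B (suc n)        ∎
    where open ≤-Reasoning
  ... | no ¬le = begin
    B (suc k)          ≡⟨ B-fall (≰⇒> ¬le) ⟩
    2 * (b ∸ suc k)    ≤⟨ *-monoʳ-≤ 2 (∸-monoʳ-≤ b (≰⇒> ¬le)) ⟩
    2 * (b ∸ suc n)    ≡⟨ sym (B-fall ≤-refl) ⟩
    B (suc n)          ∎
    where open ≤-Reasoning

  profiles : Profiles a b
  profiles = record
    { A = A ; B = B
    ; up = λ x y → phaseUp (phase x) (colKind y)
    ; down = λ x y → phaseDown (phase x) (colKind y)
    ; shift = λ x → phaseShift (phase x)
    ; right = λ y → colRight (colKind y)
    ; left = λ y → colLeft (colKind y)
    ; row-step = λ x y x<a → rowStep x<a (colKind y)
    ; col-step = λ y y<b → colStep y<b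
    ; offsets = λ x y _ _ → oddOffsets (phase x) (colKind y)
    ; A-origin = refl
    ; B-origin = refl
    ; peakRow = m
    ; peakCol = suc n
    ; peakRow<a = m<m+n m {m + 0} (s≤s z≤n)
    ; peakCol<b = subst₂ _≤_ (+-comm (suc n) 1) (sym spread) (+-monoʳ-≤ (suc n) (s≤s z≤n))
    ; A≤peak = A≤peak
    ; B≤peak = B≤peak
    }

  colours : Profiles.height profiles ≡ ascent (suc p) + 2 * n + 4
  colours = cong₂ (λ u v → u + v + 4) A-peak B-peak

  lowerBound : ∀ {N} → N ≤ ascent (suc p) + 2 * n + 4 → W≥ (Torus a b) N
  lowerBound N≤ = Profiles.height profiles , ≤-trans N≤ (≤-reflexive (sym colours))
                , ProductColouring.productColouring (3≤twice (s≤s (s≤s z≤n))) 3≤b profiles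

-- For m ≥ 2, evenness of m makes m-1 odd, which adds one colour.
even⇒odd-pred : ∀ p → suc (suc p) % 2 ≡ 0 → odd (suc p) ≡ true
even⇒odd-pred zero          _ = refl
even⇒odd-pred (suc zero)    ()
even⇒odd-pred (suc (suc p)) e = even⇒odd-pred p e

evenTori : ∀ m n → 2 ≤ m → 2 ≤ n → W≥ (Torus (2 * m) (2 * n)) (3 * m + n + 2)
evenTori (suc (suc p)) (suc (suc q)) (s≤s (s≤s z≤n)) (s≤s (s≤s z≤n)) = EvenTorus.lowerBound p q

oddTori : ∀ m n → 2 ≤ m → 1 ≤ n → W≥ (Torus (2 * m) (2 * n + 1)) (2 * m + 2 * n + 2)
oddTori (suc (suc p)) (suc q) (s≤s (s≤s z≤n)) (s≤s z≤n) = OddTorus.lowerBound p q (begin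
  2 * suc (suc p) + 2 * suc q + 2                   ≡⟨ arith p q ⟩
  2 * suc p + 2 * suc q + 4                         ≤⟨ +-monoˡ-≤ 4 (+-monoˡ-≤ (2 * suc q)
                                                              (m≤m+n (2 * suc p) (bit (odd (suc p))))) ⟩
  2 * suc p + bit (odd (suc p)) + 2 * suc q + 4     ∎)
  where open ≤-Reasoning
        arith : ∀ p q → 2 * suc (suc p) + 2 * suc q + 2 ≡ 2 * suc p + 2 * suc q + 4
        arith = solve-∀

oddTori-even : ∀ m n → 2 ≤ m → 1 ≤ n → m % 2 ≡ 0 →
  W≥ (Torus (2 * m) (2 * n + 1)) (2 * m + 2 * n + 3)
oddTori-even (suc (suc p)) (suc q) (s≤s (s≤s z≤n)) (s≤s z≤n) even = OddTorus.lowerBound p q (begin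
  2 * suc (suc p) + 2 * suc q + 3                   ≡⟨ arith p q ⟩
  2 * suc p + 1 + 2 * suc q + 4                     ≡⟨ cong (λ z → 2 * suc p + bit z + 2 * suc q + 4)
                                                            (sym (even⇒odd-pred p even)) ⟩
  2 * suc p + bit (odd (suc p)) + 2 * suc q + 4     ∎)
  where open ≤-Reasoning
        arith : ∀ p q → 2 * suc (suc p) + 2 * suc q + 3 ≡ 2 * suc p + 1 + 2 * suc q + 4
        arith = solve-∀

theorem18 :
    (∀ (m n : ℕ) → 2 ≤ m → 2 ≤ n →
      W≥ (Torus (2 * m) (2 * n)) ((3 * m + n + 2) ⊔ (3 * n + m + 2)))
    ×
    (∀ (m n : ℕ) → 2 ≤ m → 1 ≤ n →
      (m % 2 ≡ 1 → W≥ (Torus (2 * m) (2 * n + 1)) (2 * m + 2 * n + 2))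
      × (m % 2 ≡ 0 → W≥ (Torus (2 * m) (2 * n + 1)) (2 * m + 2 * n + 3)))
theorem18 =
  (λ m n 2≤m 2≤n → W≥-⊔ (evenTori m n 2≤m 2≤n) (W≥-swap (evenTori n m 2≤n 2≤m)))
  ,
  (λ m n 2≤m 1≤n → (λ _ → oddTori m n 2≤m 1≤n) , oddTori-even m n 2≤m 1≤n)
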